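{- For every $r \in \{2,\dots,9\}$ there are infinitely many integers $\Delta \geq r+2$ such that there exists a graph $G$ with maximum degree $\Delta(G)=\Delta$ and $\chi_r(G) = (r-1)\Delta(G)+1$.
   Context: Graphs are finite and simple. For a vertex $v$, $N(v)$ is its set of neighbors and $\deg(v)=|N(v)|$; $\Delta(G)$ is the maximum vertex degree. For a coloring $\phi$ and a vertex set $U$, $\phi(U)=\{\phi(u):u\in U\}$. An $r$-hued coloring of $G$ is a proper vertex coloring $\phi$ such that $|\phi(N(v))| \geq \min\{r,\deg(v)\}$ for every vertex $v$; the $r$-hued chromatic number $\chi_r(G)$ is the minimum number of colors in an $r$-hued coloring of $G$. -}

module Defs where

open import Data.Nat using (ℕ; zero; suc; _+_; _*_; _∸_; _≤_; _<_; _⊔_; _⊓_)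
open import Data.Fin using (Fin)
open import Data.Bool using (Bool; true; false; T; _∧_; not)
open import Data.List using (List; length; filter; map)
open import Data.Bool.ListAction using (any)
open import Data.Fin using (_≟_)
open import Data.Vec.Functional using (Vector)
open import Data.List using (allFin)
open import Data.Product using (Σ; ∃; _×_; _,_)
open import Relation.Binary.PropositionalEquality using (_≡_)
open import Relation.Nullary using (¬_)
open import Relation.Nullary.Decidable using (⌊_⌋)

record Graph : Set where
  field
    n        : ℕ
    adj      : Fin n → Fin n → Bool
    irrefl   : ∀ u → adj u u ≡ false
    sym      : ∀ u v → adj u v ≡ adj v u
open Graph public

Adj : (G : Graph) → Fin (n G) → Fin (n G) → Set
Adj G u v = T (adj G u v)

deg : (G : Graph) → Fin (n G) → ℕ
deg G v = length (filter (λ u → T? (adj G v u)) (allFin (n G)))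
  where
  open import Data.Bool.Properties using (T?)

-- Maximum degree Δ(G) = d : every degree ≤ d and d is attained
-- (for the empty graph on 0 vertices no d qualifies; irrelevant here since
-- d ≥ r + 2).
HasMaxDegree : Graph → ℕ → Set
HasMaxDegree G d = (∀ v → deg G v ≤ d) × ∃ λ v → deg G v ≡ d

numNbrColors : (G : Graph) {k : ℕ} → (Fin (n G) → Fin k) → Fin (n G) → ℕ
numNbrColors G {k} φ v =
  length (filter (λ c → T? (any (λ u → adj G v u ∧ ⌊ φ u ≟ c ⌋) (allFin (n G))))
                 (allFin k))
  where
  open import Data.Bool.Properties using (T?)

IsRHued : (G : Graph) (r : ℕ) {k : ℕ} → (Fin (n G) → Fin k) → Set
IsRHued G r φ =
  (∀ u v → Adj G u v → ¬ (φ u ≡ φ v)) ×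
  (∀ v → r ⊓ deg G v ≤ numNbrColors G φ v)

HasRHuedColoring : Graph → ℕ → ℕ → Set
HasRHuedColoring G r k = Σ (Fin (n G) → Fin k) (IsRHued G r)

ChiR≡ : Graph → ℕ → ℕ → Set
ChiR≡ G r m = HasRHuedColoring G r m × (∀ k → k < m → ¬ HasRHuedColoring G r k)

-- Let S be a Steiner system with blocks of size k in which every point lies on
-- Δ ≥ k blocks, so that S has (k − 1)Δ + 1 points, and let G be its point–block
-- incidence graph, of maximum degree Δ. Every block vertex has exactly k
-- neighbours, so a k-hued colouring gives the points of a block distinct colours;
-- as any two points share a block, all points get distinct colours and
-- χ_k(G) ≥ (k − 1)Δ + 1. Conversely, colour every point by itself and every block
-- by a point off it: this is k-hued as soon as each point lies on k blocks of
-- distinct colours.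
--
-- Such systems, with such colourings, and with Δ arbitrarily large, come from the
-- product S ⊗ D: its points are pairs (x, a) of points of S and D, its blocks are
-- the fibres {x} × B over blocks B of D together with the lifts of the blocks of S
-- along the rows of an orthogonal array OA(k, |D|), here given by the lines
-- α + β·j of an affine plane over a finite field. Iterating from a single block
-- (a field of order k exists for k ∈ {2, 3, 4, 5, 7, 8, 9}) or, for k = 6, from
-- the projective plane PG(2, 5) with the field of order 31, proves the theorem.
module Submission where

open import Defs hiding (sym)

open import Data.Bool using (Bool; true; false; T; not; _∧_; _∨_)
open import Data.Bool.Properties using (T?; ∨-identityʳ; ∨-zeroʳ)
import Data.Bool.ListAction as List
open import Data.Empty using (⊥; ⊥-elim)
open import Data.Fin using (Fin; zero; suc; toℕ; fromℕ<; splitAt; _↑ˡ_; _↑ʳ_; combine; remQuot; punchIn; punchOut; _≟_)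
import Data.Fin.Properties as Finₚ
open import Data.List using (allFin; filter; length; tabulate)
open import Data.Nat using (ℕ; zero; suc; _+_; _*_; _∸_; _^_; _≤_; _<_; z≤n; s≤s; _⊓_; _≡ᵇ_; NonZero; >-nonZero)
open import Data.Nat.DivMod using (_%_; _/_; _mod_)
open import Data.Nat.Properties hiding (_≟_)
open import Algebra.Properties.Semiring.Sum +-*-semiring
  using (sum; sum-cong-≗; sum-replicate-zero; ∑-distrib-+; *-distribˡ-sum)
open import Data.Nat.Tactic.RingSolver using (solve-∀)
open import Data.Product using (Σ; ∃; _×_; _,_; proj₁; proj₂; uncurry)
open import Data.Sum using (_⊎_; inj₁; inj₂; [_,_]′)
open import Data.Vec using (_∷_; []; lookup)
open import Function using (_∘_)
open import Function.Definitions using (Injective)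
open import Relation.Binary.PropositionalEquality
open import Relation.Nullary.Decidable using (⌊_⌋; yes; no; toWitness)

-- Boolean tests and counting over Fin

T⇒≡true : ∀ {b} → T b → b ≡ true
T⇒≡true {true} _ = refl

∧≡true : ∀ {a b} → a ∧ b ≡ true → a ≡ true × b ≡ true
∧≡true {true} {true} _ = refl , refl

∨-resolveˡ : ∀ {a b} → a ∨ b ≡ true → a ≡ false → b ≡ true
∨-resolveˡ a∨b refl = a∨b

indicator : Bool → ℕ
indicator true  = 1
indicator false = 0

infix 4 _==_
_==_ : ∀ {n} → Fin n → Fin n → Bool
x == y = ⌊ x ≟ y ⌋

==-refl : ∀ {n} (x : Fin n) → (x == x) ≡ true
==-refl x with x ≟ x
... | yes _   = refl
... | no x≢x = ⊥-elim (x≢x refl)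

==⇒≡ : ∀ {n} {x y : Fin n} → (x == y) ≡ true → x ≡ y
==⇒≡ x==y = toWitness (subst T (sym x==y) _)

≢⇒==-false : ∀ {n} {x y : Fin n} → x ≢ y → (x == y) ≡ false
≢⇒==-false {x = x} {y} x≢y with x ≟ y
... | yes x≡y = ⊥-elim (x≢y x≡y)
... | no _    = refl

==-≡ : ∀ {m n} {x y : Fin m} {u v : Fin n} →
       (x ≡ y → u ≡ v) → (u ≡ v → x ≡ y) → (x == y) ≡ (u == v)
==-≡ {x = x} {y} {u} {v} to from with x ≟ y | u ≟ v
... | yes _   | yes _   = refl
... | no _    | no _    = refl
... | yes x≡y | no u≢v = ⊥-elim (u≢v (to x≡y))
... | no x≢y  | yes u≡v = ⊥-elim (x≢y (from u≡v))

combine-== : ∀ {m n} (x y : Fin m) (a b : Fin n) →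
             (combine x a == combine y b) ≡ (x == y) ∧ (a == b)
combine-== x y a b with x ≟ y | a ≟ b
... | yes refl | yes refl = ==-refl (combine x a)
... | yes refl | no a≢b   = ≢⇒==-false (a≢b ∘ proj₂ ∘ Finₚ.combine-injective x a x b)
... | no x≢y   | _        = ≢⇒==-false (x≢y ∘ proj₁ ∘ Finₚ.combine-injective x a y b)

sum-mono-≤ : ∀ {n} {f g : Fin n → ℕ} → (∀ i → f i ≤ g i) → sum f ≤ sum g
sum-mono-≤ {zero}  _   = z≤n
sum-mono-≤ {suc n} f≤g = +-mono-≤ (f≤g zero) (sum-mono-≤ (f≤g ∘ suc))

sum-supported-at : ∀ {n} {f : Fin n → ℕ} x → (∀ i → i ≢ x → f i ≡ 0) → sum f ≡ f x
sum-supported-at {suc n} {f} zero f≡0 = begin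
  f zero + sum (f ∘ suc)            ≡⟨ cong (f zero +_) (sum-cong-≗ (λ i → f≡0 (suc i) λ ())) ⟩
  f zero + sum {n} (λ _ → 0)        ≡⟨ cong (f zero +_) (sum-replicate-zero n) ⟩
  f zero + 0                        ≡⟨ +-identityʳ (f zero) ⟩
  f zero                            ∎
  where open ≡-Reasoning
sum-supported-at {suc n} {f} (suc x) f≡0 rewrite f≡0 zero (λ ()) =
  sum-supported-at x (λ i i≢x → f≡0 (suc i) (i≢x ∘ Finₚ.suc-injective))

sum-↑ : ∀ m {n} (f : Fin (m + n) → ℕ) → sum f ≡ sum (f ∘ (_↑ˡ n)) + sum (f ∘ (m ↑ʳ_))
sum-↑ zero    f = refl
sum-↑ (suc m) f = trans (cong (f zero +_) (sum-↑ m (f ∘ suc))) (sym (+-assoc (f zero) _ _))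

sum-combine : ∀ m {n} (f : Fin (m * n) → ℕ) → sum f ≡ sum {m} (λ x → sum {n} (λ a → f (combine x a)))
sum-combine zero    f = refl
sum-combine (suc m) {n} f =
  trans (sum-↑ n f) (cong (sum (f ∘ (_↑ˡ (m * n))) +_) (sum-combine m (f ∘ (n ↑ʳ_))))

count : ∀ {n} → (Fin n → Bool) → ℕ
count f = sum (indicator ∘ f)

count-cong : ∀ {n} {f g : Fin n → Bool} → (∀ i → f i ≡ g i) → count f ≡ count g
count-cong f≗g = sum-cong-≗ (cong indicator ∘ f≗g)

count-none : ∀ {n} {f : Fin n → Bool} → (∀ i → f i ≡ false) → count f ≡ 0
count-none {n} f≡false = trans (count-cong f≡false) (sum-replicate-zero n)

count-mono : ∀ {n} {f g : Fin n → Bool} → (∀ i → f i ≡ true → g i ≡ true) → count f ≤ count g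
count-mono f⇒g = sum-mono-≤ (λ i → indicator-mono (f⇒g i))
  where
  indicator-mono : ∀ {a b} → (a ≡ true → b ≡ true) → indicator a ≤ indicator b
  indicator-mono {false} _   = z≤n
  indicator-mono {true}  a⇒b rewrite a⇒b refl = ≤-refl

count-∨ : ∀ {n} (f g : Fin n → Bool) → count (λ i → f i ∨ g i) ≤ count f + count g
count-∨ f g = ≤-trans (sum-mono-≤ (λ i → indicator-∨ (f i) (g i)))
                      (≤-reflexive (∑-distrib-+ (indicator ∘ f) (indicator ∘ g)))
  where
  indicator-∨ : ∀ a b → indicator (a ∨ b) ≤ indicator a + indicator b
  indicator-∨ true  _ = s≤s z≤n
  indicator-∨ false _ = ≤-refl

count-∨-disjoint : ∀ {n} (f g : Fin n → Bool) → (∀ i → f i ≡ true → g i ≡ true → ⊥) →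
                   count (λ i → f i ∨ g i) ≡ count f + count g
count-∨-disjoint f g disjoint =
  trans (sum-cong-≗ (λ i → indicator-∨-disjoint (f i) (g i) (disjoint i)))
        (∑-distrib-+ (indicator ∘ f) (indicator ∘ g))
  where
  indicator-∨-disjoint : ∀ a b → (a ≡ true → b ≡ true → ⊥) → indicator (a ∨ b) ≡ indicator a + indicator b
  indicator-∨-disjoint true  true  a∧b = ⊥-elim (a∧b refl refl)
  indicator-∨-disjoint true  false _   = refl
  indicator-∨-disjoint false _     _   = refl

count-==ˡ : ∀ {n} (x : Fin n) → count (x ==_) ≡ 1
count-==ˡ x = trans (sum-supported-at x (λ y y≢x → cong indicator (≢⇒==-false (y≢x ∘ sym))))
                    (cong indicator (==-refl x))

count-all : ∀ n → count {n} (λ _ → true) ≡ n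
count-all zero    = refl
count-all (suc n) = cong suc (count-all n)

count>0⇒∃ : ∀ {n} (f : Fin n → Bool) → 0 < count f → ∃ λ i → f i ≡ true
count>0⇒∃ {suc n} f pos with f zero in fzero
... | true  = zero , fzero
... | false = let i , fi = count>0⇒∃ (f ∘ suc) pos in suc i , fi

any : ∀ {n} → (Fin n → Bool) → Bool
any {zero}  f = false
any {suc n} f = f zero ∨ any (f ∘ suc)

any-intro : ∀ {n} {f : Fin n → Bool} i → f i ≡ true → any f ≡ true
any-intro {f = f} zero    fi rewrite fi = refl
any-intro {f = f} (suc i) fi = trans (cong (f zero ∨_) (any-intro {f = f ∘ suc} i fi)) (∨-zeroʳ (f zero))

any-elim : ∀ {n} (f : Fin n → Bool) → any f ≡ true → ∃ λ i → f i ≡ true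
any-elim {suc n} f any-f with f zero in fzero
... | true  = zero , fzero
... | false = let i , fi = any-elim (f ∘ suc) any-f in suc i , fi

any-cong : ∀ {n} {f g : Fin n → Bool} → (∀ i → f i ≡ g i) → any f ≡ any g
any-cong {zero}  f≗g = refl
any-cong {suc n} f≗g = cong₂ _∨_ (f≗g zero) (any-cong (f≗g ∘ suc))

any-none : ∀ {n} {f : Fin n → Bool} → (∀ i → f i ≡ false) → any f ≡ false
any-none {zero}  f≡false = refl
any-none {suc n} f≡false rewrite f≡false zero = any-none (f≡false ∘ suc)

any-supported-at : ∀ {n} {f : Fin n → Bool} x → (∀ i → i ≢ x → f i ≡ false) → any f ≡ f x
any-supported-at {f = f} zero f≡false =
  trans (cong (f zero ∨_) (any-none (λ i → f≡false (suc i) λ ()))) (∨-identityʳ (f zero))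
any-supported-at {f = f} (suc x) f≡false rewrite f≡false zero (λ ()) =
  any-supported-at x (λ i i≢x → f≡false (suc i) (i≢x ∘ Finₚ.suc-injective))

any-∧ˡ : ∀ {n} b (f : Fin n → Bool) → any (λ i → b ∧ f i) ≡ b ∧ any f
any-∧ˡ true  f = refl
any-∧ˡ {n} false f = any-none {n} (λ _ → refl)

all : ∀ {n} → (Fin n → Bool) → Bool
all {zero}  f = true
all {suc n} f = f zero ∧ all (f ∘ suc)

all-sound : ∀ {n} (f : Fin n → Bool) → all f ≡ true → ∀ i → f i ≡ true
all-sound f ok zero    = proj₁ (∧≡true ok)
all-sound f ok (suc i) = all-sound (f ∘ suc) (proj₂ (∧≡true {f zero} ok)) i

all₂-sound : ∀ {m n} (f : Fin m → Fin n → Bool) → all (λ x → all (f x)) ≡ true → ∀ x y → f x y ≡ true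
all₂-sound f ok x = all-sound (f x) (all-sound (λ x → all (f x)) ok x)

∣image∣ : ∀ {m K} → (Fin m → Fin K) → ℕ
∣image∣ f = count (λ c → any (λ i → f i == c))

∣image∣-≤ : ∀ {m K} (f : Fin m → Fin K) → ∣image∣ f ≤ m
∣image∣-≤ {zero} {K} f = ≤-reflexive (count-none {K} (λ _ → refl))
∣image∣-≤ {suc m} f = ≤-trans (count-∨ (f zero ==_) (λ c → any (λ i → f (suc i) == c)))
                              (+-mono-≤ (≤-reflexive (count-==ˡ (f zero))) (∣image∣-≤ (f ∘ suc)))

∣image∣-injective : ∀ {m K} (f : Fin m → Fin K) → Injective _≡_ _≡_ f → ∣image∣ f ≡ m
∣image∣-injective {zero} {K} f _ = count-none {K} (λ _ → refl)
∣image∣-injective {suc m} f inj =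
  trans (count-∨-disjoint (f zero ==_) (λ c → any (λ i → f (suc i) == c)) disjoint)
        (cong₂ _+_ (count-==ˡ (f zero)) (∣image∣-injective (f ∘ suc) (Finₚ.suc-injective ∘ inj)))
  where
  disjoint : ∀ c → (f zero == c) ≡ true → any (λ i → f (suc i) == c) ≡ true → ⊥
  disjoint c f0≡c fi≡c with i , fi==c ← any-elim _ fi≡c
    with () ← inj {zero} {suc i} (trans (==⇒≡ f0≡c) (sym (==⇒≡ fi==c)))

∣image∣-collision : ∀ {m K} (f : Fin m → Fin K) {i i′} → i ≢ i′ → f i ≡ f i′ → ∣image∣ f < m
∣image∣-collision {suc m} f {i} {i′} i≢i′ fi≡fi′ =
  s≤s (≤-trans (count-mono f-covered-by-rest) (∣image∣-≤ (f ∘ punchIn i)))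
  where
  f-covered-by-rest : ∀ c → any (λ j → f j == c) ≡ true → any (λ j → f (punchIn i j) == c) ≡ true
  f-covered-by-rest c fj≡c with j , fj==c ← any-elim _ fj≡c with i Finₚ.≟ j
  ... | yes refl = any-intro (punchOut i≢i′)
        (trans (cong (λ z → f z == c) (Finₚ.punchIn-punchOut i≢i′)) (trans (cong (_== c) (sym fi≡fi′)) fj==c))
  ... | no i≢j   = any-intro (punchOut i≢j) (trans (cong (λ z → f z == c) (Finₚ.punchIn-punchOut i≢j)) fj==c)

length-filter-tabulate : ∀ {A : Set} {n} (h : A → Bool) (f : Fin n → A) →
                         length (filter (T? ∘ h) (tabulate f)) ≡ count (h ∘ f)
length-filter-tabulate {n = zero}  h f = refl
length-filter-tabulate {n = suc n} h f with h (f zero)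
... | true  = cong suc (length-filter-tabulate h (f ∘ suc))
... | false = length-filter-tabulate h (f ∘ suc)

any-tabulate : ∀ {A : Set} {n} (h : A → Bool) (f : Fin n → A) → List.any h (tabulate f) ≡ any (h ∘ f)
any-tabulate {n = zero}  h f = refl
any-tabulate {n = suc n} h f = cong (h (f zero) ∨_) (any-tabulate h (f ∘ suc))

deg≡count : ∀ G v → deg G v ≡ count (adj G v)
deg≡count G v = length-filter-tabulate (adj G v) (λ u → u)

nbrColours : (G : Graph) {K : ℕ} → (Fin (n G) → Fin K) → Fin (n G) → ℕ
nbrColours G φ v = count (λ c → any (λ u → adj G v u ∧ (φ u == c)))

numNbrColors≡nbrColours : ∀ G {K} (φ : Fin (n G) → Fin K) v → numNbrColors G φ v ≡ nbrColours G φ v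
numNbrColors≡nbrColours G {K} φ v =
  trans (length-filter-tabulate (λ c → List.any (λ u → adj G v u ∧ (φ u == c)) (allFin (n G))) (λ c → c))
        (count-cong λ c → any-tabulate (λ u → adj G v u ∧ (φ u == c)) (λ u → u))

nbrColours-≥ : ∀ G {K m} (φ : Fin (n G) → Fin K) v (u : Fin m → Fin (n G)) →
               (∀ i → adj G v (u i) ≡ true) → Injective _≡_ _≡_ (φ ∘ u) → m ≤ nbrColours G φ v
nbrColours-≥ G φ v u adjacent injective =
  ≤-trans (≤-reflexive (sym (∣image∣-injective (φ ∘ u) injective))) (count-mono image⊆nbrColours)
  where
  image⊆nbrColours : ∀ c → any (λ i → φ (u i) == c) ≡ true → any (λ w → adj G v w ∧ (φ w == c)) ≡ true
  image⊆nbrColours c φui≡c with i , φui==c ← any-elim _ φui≡c =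
    any-intro (u i) (trans (cong (_∧ (φ (u i) == c)) (adjacent i)) φui==c)

-- Designs and their incidence graphs

OnBlock : ∀ {k P L} → (Fin L → Fin k → Fin P) → Fin P → Fin L → Set
OnBlock point x b = ∃ λ i → point b i ≡ x

incident : ∀ {k P L} → (Fin L → Fin k → Fin P) → Fin P → Fin L → Bool
incident point x b = any (λ i → point b i == x)

OnBlock⇒incident : ∀ {k P L} (point : Fin L → Fin k → Fin P) {x b} → OnBlock point x b → incident point x b ≡ true
OnBlock⇒incident point {x} (i , pbi≡x) = any-intro i (trans (cong (_== x) pbi≡x) (==-refl x))

incident⇒OnBlock : ∀ {k P L} (point : Fin L → Fin k → Fin P) {x b} → incident point x b ≡ true → OnBlock point x b
incident⇒OnBlock point x∈b with i , pbi==x ← any-elim _ x∈b = i , ==⇒≡ pbi==x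

record Design (k : ℕ) : Set where
  field
    points blocks replication : ℕ
    point              : Fin blocks → Fin k → Fin points
    point-injective    : ∀ b → Injective _≡_ _≡_ (point b)
    replication-count  : ∀ x → count (λ b → incident point x b) ≡ replication
    pair-covered       : ∀ {x y} → x ≢ y → ∃ λ b → OnBlock point x b × OnBlock point y b
    points≡            : points ≡ (k ∸ 1) * replication + 1
    replication>0      : 0 < replication

  points>0 : 0 < points
  points>0 = subst (0 <_) (sym (trans points≡ (+-comm _ 1))) (s≤s z≤n)

  a-point : Fin points
  a-point = fromℕ< points>0

  1<points : 2 ≤ k → 1 < points
  1<points 2≤k = subst (1 <_) (sym points≡) (+-monoˡ-≤ 1 (*-mono-≤ (∸-monoˡ-≤ 1 2≤k) replication>0))

record BlockColouring {k} (S : Design k) : Set where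
  open Design S
  field
    colour           : Fin blocks → Fin points
    colour-off-block : ∀ b i → point b i ≢ colour b
    rainbow          : ∀ x → Σ (Fin k → Fin blocks) λ e →
                       (∀ i → OnBlock point x (e i)) × Injective _≡_ _≡_ (colour ∘ e)

module IncidenceGraph {k} (S : Design k) where
  open Design S

  adjacent : Fin points ⊎ Fin blocks → Fin points ⊎ Fin blocks → Bool
  adjacent (inj₁ x) (inj₁ y) = false
  adjacent (inj₁ x) (inj₂ b) = incident point x b
  adjacent (inj₂ b) (inj₁ x) = incident point x b
  adjacent (inj₂ b) (inj₂ c) = false

  adjacent-irrefl : ∀ u → adjacent u u ≡ false
  adjacent-irrefl (inj₁ x) = refl
  adjacent-irrefl (inj₂ b) = refl

  adjacent-sym : ∀ u v → adjacent u v ≡ adjacent v u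
  adjacent-sym (inj₁ x) (inj₁ y) = refl
  adjacent-sym (inj₁ x) (inj₂ b) = refl
  adjacent-sym (inj₂ b) (inj₁ x) = refl
  adjacent-sym (inj₂ b) (inj₂ c) = refl

  graph : Graph
  graph = record
    { n      = points + blocks
    ; adj    = λ u v → adjacent (splitAt points u) (splitAt points v)
    ; irrefl = λ u → adjacent-irrefl (splitAt points u)
    ; sym    = λ u v → adjacent-sym (splitAt points u) (splitAt points v)
    }

  pointᵥ : Fin points → Fin (points + blocks)
  pointᵥ x = x ↑ˡ blocks

  blockᵥ : Fin blocks → Fin (points + blocks)
  blockᵥ b = points ↑ʳ b

  data VertexView : Fin (points + blocks) → Set where
    pointᵛ : ∀ x → VertexView (pointᵥ x)
    blockᵛ : ∀ b → VertexView (blockᵥ b)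

  view : ∀ v → VertexView v
  view v with splitAt points v in eq
  ... | inj₁ x = subst VertexView (Finₚ.splitAt⁻¹-↑ˡ eq) (pointᵛ x)
  ... | inj₂ b = subst VertexView (Finₚ.splitAt⁻¹-↑ʳ eq) (blockᵛ b)

  adj-point-point : ∀ x y → adj graph (pointᵥ x) (pointᵥ y) ≡ false
  adj-point-point x y rewrite Finₚ.splitAt-↑ˡ points x blocks | Finₚ.splitAt-↑ˡ points y blocks = refl

  adj-point-block : ∀ x b → adj graph (pointᵥ x) (blockᵥ b) ≡ incident point x b
  adj-point-block x b rewrite Finₚ.splitAt-↑ˡ points x blocks | Finₚ.splitAt-↑ʳ points blocks b = refl

  adj-block-point : ∀ b x → adj graph (blockᵥ b) (pointᵥ x) ≡ incident point x b
  adj-block-point b x rewrite Finₚ.splitAt-↑ˡ points x blocks | Finₚ.splitAt-↑ʳ points blocks b = refl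

  adj-block-block : ∀ b c → adj graph (blockᵥ b) (blockᵥ c) ≡ false
  adj-block-block b c rewrite Finₚ.splitAt-↑ʳ points blocks b | Finₚ.splitAt-↑ʳ points blocks c = refl

  deg-split : ∀ v → deg graph v ≡ count (λ x → adj graph v (pointᵥ x)) + count (λ b → adj graph v (blockᵥ b))
  deg-split v = trans (deg≡count graph v) (sum-↑ points (indicator ∘ adj graph v))

  deg-point : ∀ x → deg graph (pointᵥ x) ≡ replication
  deg-point x = begin
    deg graph (pointᵥ x)
      ≡⟨ deg-split (pointᵥ x) ⟩
    count (λ y → adj graph (pointᵥ x) (pointᵥ y)) + count (λ b → adj graph (pointᵥ x) (blockᵥ b))
      ≡⟨ cong₂ _+_ (count-none (adj-point-point x)) (count-cong (adj-point-block x)) ⟩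
    0 + count (incident point x)
      ≡⟨ replication-count x ⟩
    replication ∎
    where open ≡-Reasoning

  deg-block : ∀ b → deg graph (blockᵥ b) ≡ k
  deg-block b = begin
    deg graph (blockᵥ b)
      ≡⟨ deg-split (blockᵥ b) ⟩
    count (λ x → adj graph (blockᵥ b) (pointᵥ x)) + count (λ c → adj graph (blockᵥ b) (blockᵥ c))
      ≡⟨ cong₂ _+_ (count-cong (adj-block-point b)) (count-none (adj-block-block b)) ⟩
    ∣image∣ (point b) + 0
      ≡⟨ +-identityʳ _ ⟩
    ∣image∣ (point b)
      ≡⟨ ∣image∣-injective (point b) (point-injective b) ⟩
    k ∎
    where open ≡-Reasoning

  nbrColours-block-≤ : ∀ {K} (φ : Fin (points + blocks) → Fin K) b →
                       nbrColours graph φ (blockᵥ b) ≤ ∣image∣ (φ ∘ pointᵥ ∘ point b)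
  nbrColours-block-≤ φ b = count-mono nbr⊆image
    where
    nbr⊆image : ∀ c → any (λ v → adj graph (blockᵥ b) v ∧ (φ v == c)) ≡ true →
                any (λ i → φ (pointᵥ (point b i)) == c) ≡ true
    nbr⊆image c nbr with v , bv∧φv==c ← any-elim _ nbr with view v
    ... | pointᵛ x with bx , φx==c ← ∧≡true bv∧φv==c
                   with i , refl ← incident⇒OnBlock point (trans (sym (adj-block-point b x)) bx) = any-intro i φx==c
    ... | blockᵛ c′ with () ← trans (sym (adj-block-block b c′)) (proj₁ (∧≡true bv∧φv==c))

  module _ {K} {φ : Fin (points + blocks) → Fin K} (φ-hued : IsRHued graph k φ) where

    hued-at-block : ∀ b → k ≤ nbrColours graph φ (blockᵥ b)
    hued-at-block b = subst₂ _≤_ (trans (cong (k ⊓_) (deg-block b)) (⊓-idem k))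
                                 (numNbrColors≡nbrColours graph φ (blockᵥ b)) (proj₂ φ-hued (blockᵥ b))

    hued⇒block-injective : ∀ b → Injective _≡_ _≡_ (φ ∘ pointᵥ ∘ point b)
    hued⇒block-injective b {i} {j} φi≡φj with i Finₚ.≟ j
    ... | yes i≡j = i≡j
    ... | no i≢j  = ⊥-elim (<-irrefl refl (begin-strict
      k                                    ≤⟨ hued-at-block b ⟩
      nbrColours graph φ (blockᵥ b)        ≤⟨ nbrColours-block-≤ φ b ⟩
      ∣image∣ (φ ∘ pointᵥ ∘ point b)       <⟨ ∣image∣-collision _ i≢j φi≡φj ⟩
      k                                    ∎))
      where open ≤-Reasoning

    hued⇒points-injective : Injective _≡_ _≡_ (φ ∘ pointᵥ)
    hued⇒points-injective {x} {y} φx≡φy with x Finₚ.≟ y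
    ... | yes x≡y = x≡y
    ... | no x≢y with b , (i , refl) , (j , refl) ← pair-covered x≢y =
      ⊥-elim (x≢y (cong (point b) (hued⇒block-injective b φx≡φy)))

    hued⇒points≤colours : points ≤ K
    hued⇒points≤colours = Finₚ.injective⇒≤ hued⇒points-injective

  module _ (C : BlockColouring S) where
    open BlockColouring C

    colouring : Fin (points + blocks) → Fin points
    colouring v = [ (λ x → x) , colour ]′ (splitAt points v)

    colouring-point : ∀ x → colouring (pointᵥ x) ≡ x
    colouring-point x rewrite Finₚ.splitAt-↑ˡ points x blocks = refl

    colouring-block : ∀ b → colouring (blockᵥ b) ≡ colour b
    colouring-block b rewrite Finₚ.splitAt-↑ʳ points blocks b = refl

    incident⇒≢colour : ∀ {x b} → T (incident point x b) → x ≢ colour b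
    incident⇒≢colour {b = b} x∈b x≡cb with i , pbi≡x ← incident⇒OnBlock point (T⇒≡true x∈b) =
      colour-off-block b i (trans pbi≡x x≡cb)

    colouring-proper : ∀ u v → Adj graph u v → colouring u ≢ colouring v
    colouring-proper u v uv with view u | view v
    ... | pointᵛ x | pointᵛ y = ⊥-elim (subst T (adj-point-point x y) uv)
    ... | pointᵛ x | blockᵛ b = λ eq → incident⇒≢colour (subst T (adj-point-block x b) uv)
                                         (trans (sym (colouring-point x)) (trans eq (colouring-block b)))
    ... | blockᵛ b | pointᵛ x = λ eq → incident⇒≢colour (subst T (adj-block-point b x) uv)
                                         (trans (sym (colouring-point x)) (trans (sym eq) (colouring-block b)))
    ... | blockᵛ b | blockᵛ c = ⊥-elim (subst T (adj-block-block b c) uv)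

    colouring-hued : ∀ v → k ≤ nbrColours graph colouring v
    colouring-hued v with view v
    ... | pointᵛ x with e , e∋x , e-rainbow ← rainbow x =
      nbrColours-≥ graph colouring (pointᵥ x) (blockᵥ ∘ e)
        (λ i → trans (adj-point-block x (e i)) (OnBlock⇒incident point (e∋x i)))
        (λ {i} {i′} eq → e-rainbow (trans (sym (colouring-block (e i))) (trans eq (colouring-block (e i′)))))
    ... | blockᵛ b =
      nbrColours-≥ graph colouring (blockᵥ b) (pointᵥ ∘ point b)
        (λ i → trans (adj-block-point b (point b i)) (OnBlock⇒incident point (i , refl)))
        (λ eq → point-injective b (trans (sym (colouring-point _)) (trans eq (colouring-point _))))

    colouring-rHued : IsRHued graph k colouring
    colouring-rHued = colouring-proper , λ v →
      ≤-trans (m⊓n≤m k (deg graph v)) (subst (k ≤_) (sym (numNbrColors≡nbrColours graph colouring v)) (colouring-hued v))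

  incidenceGraph-extremal : BlockColouring S → k ≤ replication →
                            HasMaxDegree graph replication × ChiR≡ graph k points
  incidenceGraph-extremal C k≤r =
    (deg≤r , pointᵥ a-point , deg-point a-point) ,
    (colouring C , colouring-rHued C) , λ K K<points (φ , φ-hued) → <⇒≱ K<points (hued⇒points≤colours φ-hued)
    where
    deg≤r : ∀ v → deg graph v ≤ replication
    deg≤r v with view v
    ... | pointᵛ x = ≤-reflexive (deg-point x)
    ... | blockᵛ b = ≤-trans (≤-reflexive (deg-block b)) k≤r

-- The product of designs

another : ∀ {n} → 1 < n → Fin n → Fin n
another (s≤s (s≤s _)) zero    = suc zero
another (s≤s (s≤s _)) (suc _) = zero

another-≢ : ∀ {n} (1<n : 1 < n) x → another 1<n x ≢ x
another-≢ (s≤s (s≤s _)) zero    ()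
another-≢ (s≤s (s≤s _)) (suc _) ()

-- In the product, the label of a row chooses the point that colours a lifted
-- block; every cell (j, a) has to meet rows of all labels.
record LabelledOA (k w : ℕ) : Set where
  field
    rows           : ℕ
    entry          : Fin rows → Fin k → Fin w
    entry-count    : ∀ j a → count (λ g → entry g j == a) ≡ w
    pair-covered   : ∀ {j j′} a a′ → j ≢ j′ → ∃ λ g → entry g j ≡ a × entry g j′ ≡ a′
    label          : Fin rows → Fin k
    labels-through : ∀ j a i → ∃ λ g → entry g j ≡ a × label g ≡ i

product-size : ∀ c r rD → (c * r + 1) * (c * rD + 1) ≡ c * (rD + (c * rD + 1) * r) + 1
product-size = solve-∀

module Product {k} (S D : Design k) (A : LabelledOA k (Design.points D)) where
  open Design S
  module D = Design D
  open LabelledOA A renaming (pair-covered to entries-covered)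

  w : ℕ
  w = D.points

  fibres lifts : ℕ
  fibres = points * D.blocks
  lifts  = blocks * rows

  fibre : Fin points → Fin D.blocks → Fin (fibres + lifts)
  fibre x d = combine x d ↑ˡ lifts

  lift : Fin blocks → Fin rows → Fin (fibres + lifts)
  lift ℓ g = fibres ↑ʳ combine ℓ g

  byBlock : ∀ {B : Set} → (Fin points → Fin D.blocks → B) → (Fin blocks → Fin rows → B) → Fin (fibres + lifts) → B
  byBlock f h β = [ uncurry f ∘ remQuot D.blocks , uncurry h ∘ remQuot rows ]′ (splitAt fibres β)

  byBlock-fibre : ∀ {B : Set} f h x d → byBlock {B} f h (fibre x d) ≡ f x d
  byBlock-fibre f h x d rewrite Finₚ.splitAt-↑ˡ fibres (combine x d) lifts =
    cong (uncurry f) (Finₚ.remQuot-combine x d)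

  byBlock-lift : ∀ {B : Set} f h ℓ g → byBlock {B} f h (lift ℓ g) ≡ h ℓ g
  byBlock-lift f h ℓ g rewrite Finₚ.splitAt-↑ʳ fibres lifts (combine ℓ g) =
    cong (uncurry h) (Finₚ.remQuot-combine ℓ g)

  data BlockView : Fin (fibres + lifts) → Set where
    fibreᵛ : ∀ x d → BlockView (fibre x d)
    liftᵛ  : ∀ ℓ g → BlockView (lift ℓ g)

  blockView : ∀ β → BlockView β
  blockView β with splitAt fibres β in eq
  ... | inj₁ u with x , d , refl ← Finₚ.combine-surjective {points} {D.blocks} u =
    subst BlockView (Finₚ.splitAt⁻¹-↑ˡ eq) (fibreᵛ x d)
  ... | inj₂ u with ℓ , g , refl ← Finₚ.combine-surjective {blocks} {rows} u =
    subst BlockView (Finₚ.splitAt⁻¹-↑ʳ eq) (liftᵛ ℓ g)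

  fibrePoint : Fin points → Fin D.blocks → Fin k → Fin (points * w)
  fibrePoint x d i = combine x (D.point d i)

  liftPoint : Fin blocks → Fin rows → Fin k → Fin (points * w)
  liftPoint ℓ g i = combine (point ℓ i) (entry g i)

  point′ : Fin (fibres + lifts) → Fin k → Fin (points * w)
  point′ = byBlock fibrePoint liftPoint

  point′-fibre : ∀ x d i → point′ (fibre x d) i ≡ combine x (D.point d i)
  point′-fibre x d i = cong (λ pt → pt i) (byBlock-fibre fibrePoint liftPoint x d)

  point′-lift : ∀ ℓ g i → point′ (lift ℓ g) i ≡ combine (point ℓ i) (entry g i)
  point′-lift ℓ g i = cong (λ pt → pt i) (byBlock-lift fibrePoint liftPoint ℓ g)

  point′-injective : ∀ β → Injective _≡_ _≡_ (point′ β)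
  point′-injective β {i} {j} eq with blockView β
  ... | fibreᵛ x d = D.point-injective d (proj₂ (Finₚ.combine-injective x _ x _
                       (trans (sym (point′-fibre x d i)) (trans eq (point′-fibre x d j)))))
  ... | liftᵛ ℓ g  = point-injective ℓ (proj₁ (Finₚ.combine-injective _ _ _ _
                       (trans (sym (point′-lift ℓ g i)) (trans eq (point′-lift ℓ g j)))))

  fibre-incident : ∀ x a x′ d → incident point′ (combine x a) (fibre x′ d) ≡ (x′ == x) ∧ incident D.point a d
  fibre-incident x a x′ d = begin
    any (λ i → point′ (fibre x′ d) i == combine x a)
      ≡⟨ any-cong (λ i → trans (cong (_== combine x a) (point′-fibre x′ d i)) (combine-== x′ x (D.point d i) a)) ⟩
    any (λ i → (x′ == x) ∧ (D.point d i == a))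
      ≡⟨ any-∧ˡ (x′ == x) (λ i → D.point d i == a) ⟩
    (x′ == x) ∧ incident D.point a d ∎
    where open ≡-Reasoning

  lift-incident : ∀ x a ℓ g →
                  incident point′ (combine x a) (lift ℓ g) ≡ any (λ j → (point ℓ j == x) ∧ (entry g j == a))
  lift-incident x a ℓ g =
    any-cong (λ j → trans (cong (_== combine x a) (point′-lift ℓ g j)) (combine-== (point ℓ j) x (entry g j) a))

  fibres-count : ∀ x a → sum (λ x′ → count (λ d → incident point′ (combine x a) (fibre x′ d))) ≡ D.replication
  fibres-count x a = trans (sum-supported-at x other-fibre) (trans (count-cong own-fibre) (D.replication-count a))
    where
    other-fibre : ∀ x′ → x′ ≢ x → count (λ d → incident point′ (combine x a) (fibre x′ d)) ≡ 0
    other-fibre x′ x′≢x = count-none (λ d → trans (fibre-incident x a x′ d) (cong (_∧ _) (≢⇒==-false x′≢x)))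
    own-fibre : ∀ d → incident point′ (combine x a) (fibre x d) ≡ incident D.point a d
    own-fibre d = trans (fibre-incident x a x d) (cong (_∧ _) (==-refl x))

  lift-count : ∀ x a ℓ → count (λ g → incident point′ (combine x a) (lift ℓ g)) ≡ w * indicator (incident point x ℓ)
  lift-count x a ℓ with incident point x ℓ in x∈ℓ
  ... | true with j , refl ← incident⇒OnBlock point x∈ℓ = begin
    count (λ g → incident point′ (combine (point ℓ j) a) (lift ℓ g))
      ≡⟨ count-cong (λ g → trans (lift-incident _ a ℓ g) (any-supported-at j (other-columns g))) ⟩
    count (λ g → (point ℓ j == point ℓ j) ∧ (entry g j == a))
      ≡⟨ count-cong (λ g → cong (_∧ (entry g j == a)) (==-refl (point ℓ j))) ⟩
    count (λ g → entry g j == a)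
      ≡⟨ entry-count j a ⟩
    w
      ≡⟨ sym (*-identityʳ w) ⟩
    w * 1 ∎
    where
    open ≡-Reasoning
    other-columns : ∀ g j′ → j′ ≢ j → (point ℓ j′ == point ℓ j) ∧ (entry g j′ == a) ≡ false
    other-columns g j′ j′≢j = cong (_∧ _) (≢⇒==-false (j′≢j ∘ point-injective ℓ))
  ... | false = trans (count-none (λ g → trans (lift-incident x a ℓ g) (any-none (λ j → cong (_∧ _) (off-block j)))))
                      (sym (*-zeroʳ w))
    where
    off-block : ∀ j → (point ℓ j == x) ≡ false
    off-block j with point ℓ j == x in ℓj==x
    ... | false = refl
    ... | true with () ← trans (sym (OnBlock⇒incident point (j , ==⇒≡ ℓj==x))) x∈ℓ

  replication-count′ : ∀ p → count (λ β → incident point′ p β) ≡ D.replication + w * replication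
  replication-count′ p with x , a , refl ← Finₚ.combine-surjective {points} {w} p =
    trans (sum-↑ fibres (indicator ∘ incident point′ (combine x a)))
          (cong₂ _+_ (trans (sum-combine points _) (fibres-count x a))
                     (trans (sum-combine blocks _) lifts-count))
    where
    lifts-count : sum (λ ℓ → count (λ g → incident point′ (combine x a) (lift ℓ g))) ≡ w * replication
    lifts-count = trans (sum-cong-≗ (lift-count x a))
                        (trans (sym (*-distribˡ-sum w (indicator ∘ incident point x)))
                               (cong (w *_) (replication-count x)))

  pair-covered′ : ∀ {p q} → p ≢ q → ∃ λ β → OnBlock point′ p β × OnBlock point′ q β
  pair-covered′ {p} {q} p≢q with x , a , refl ← Finₚ.combine-surjective {points} {w} p
                             with y , b , refl ← Finₚ.combine-surjective {points} {w} q
                             with x Finₚ.≟ y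
  ... | yes refl with d , (i , di≡a) , (j , dj≡b) ← D.pair-covered (p≢q ∘ cong (combine x)) =
    fibre x d , (i , trans (point′-fibre x d i) (cong (combine x) di≡a))
              , (j , trans (point′-fibre x d j) (cong (combine x) dj≡b))
  ... | no x≢y with ℓ , (i , refl) , (j , refl) ← pair-covered x≢y
               with g , gi≡a , gj≡b ← entries-covered a b (x≢y ∘ cong (point ℓ)) =
    lift ℓ g , (i , trans (point′-lift ℓ g i) (cong (combine (point ℓ i)) gi≡a))
             , (j , trans (point′-lift ℓ g j) (cong (combine (point ℓ j)) gj≡b))

  points≡′ : points * w ≡ (k ∸ 1) * (D.replication + w * replication) + 1
  points≡′ = begin
    points * w                                                    ≡⟨ cong₂ _*_ points≡ D.points≡ ⟩
    ((k ∸ 1) * replication + 1) * ((k ∸ 1) * D.replication + 1)   ≡⟨ product-size (k ∸ 1) replication D.replication ⟩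
    (k ∸ 1) * (D.replication + ((k ∸ 1) * D.replication + 1) * replication) + 1
      ≡⟨ cong (λ v → (k ∸ 1) * (D.replication + v * replication) + 1) (sym D.points≡) ⟩
    (k ∸ 1) * (D.replication + w * replication) + 1               ∎
    where open ≡-Reasoning

  product : Design k
  product = record
    { points            = points * w
    ; blocks            = fibres + lifts
    ; replication       = D.replication + w * replication
    ; point             = point′
    ; point-injective   = point′-injective
    ; replication-count = replication-count′
    ; pair-covered      = pair-covered′
    ; points≡           = points≡′
    ; replication>0     = ≤-trans D.replication>0 (m≤m+n D.replication (w * replication))
    }

  module _ (2≤k : 2 ≤ k) where

    fibreColour : Fin points → Fin D.blocks → Fin (points * w)
    fibreColour x d = combine (another (1<points 2≤k) x) D.a-point

    -- A lift is coloured by a point it misses in the fibre over its label-th point.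
    liftColour : Fin blocks → Fin rows → Fin (points * w)
    liftColour ℓ g = combine (point ℓ (label g)) (another (D.1<points 2≤k) (entry g (label g)))

    colour′ : Fin (fibres + lifts) → Fin (points * w)
    colour′ = byBlock fibreColour liftColour

    colour′-fibre : ∀ x d → colour′ (fibre x d) ≡ fibreColour x d
    colour′-fibre = byBlock-fibre fibreColour liftColour

    colour′-lift : ∀ ℓ g → colour′ (lift ℓ g) ≡ liftColour ℓ g
    colour′-lift = byBlock-lift fibreColour liftColour

    colour′-off-block : ∀ β i → point′ β i ≢ colour′ β
    colour′-off-block β i eq with blockView β
    ... | fibreᵛ x d = another-≢ _ x (sym (proj₁ (Finₚ.combine-injective _ _ _ _
                         (trans (sym (point′-fibre x d i)) (trans eq (colour′-fibre x d))))))
    ... | liftᵛ ℓ g with i≡label , entries≡ ← Finₚ.combine-injective _ _ _ _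
                           (trans (sym (point′-lift ℓ g i)) (trans eq (colour′-lift ℓ g)))
                    with refl ← point-injective ℓ i≡label = another-≢ _ (entry g i) (sym entries≡)

    rainbow′ : ∀ p → Σ (Fin k → Fin (fibres + lifts)) λ e →
               (∀ i → OnBlock point′ p (e i)) × Injective _≡_ _≡_ (colour′ ∘ e)
    rainbow′ p with x , a , refl ← Finₚ.combine-surjective {points} {w} p
               with ℓ , x∈ℓ ← count>0⇒∃ (incident point x) (subst (0 <_) (sym (replication-count x)) replication>0)
               with j , refl ← incident⇒OnBlock point x∈ℓ =
      lift ℓ ∘ row , (λ i → j , trans (point′-lift ℓ (row i) j) (cong (combine (point ℓ j)) (row-entry i))) , injective
      where
      row : Fin k → Fin rows
      row i = proj₁ (labels-through j a i)
      row-entry : ∀ i → entry (row i) j ≡ a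
      row-entry i = proj₁ (proj₂ (labels-through j a i))
      row-label : ∀ i → label (row i) ≡ i
      row-label i = proj₂ (proj₂ (labels-through j a i))
      injective : Injective _≡_ _≡_ (colour′ ∘ lift ℓ ∘ row)
      injective {i} {i′} eq =
        trans (sym (row-label i)) (trans (point-injective ℓ same-point) (row-label i′))
        where
        same-point : point ℓ (label (row i)) ≡ point ℓ (label (row i′))
        same-point = proj₁ (Finₚ.combine-injective _ _ _ _
                       (trans (sym (colour′-lift ℓ (row i))) (trans eq (colour′-lift ℓ (row i′)))))

    productColouring : BlockColouring product
    productColouring = record { colour = colour′ ; colour-off-block = colour′-off-block ; rainbow = rainbow′ }

powers : ∀ {k} (D : Design k) → LabelledOA k (Design.points D) → ℕ → Design k
powers D A zero    = D
powers D A (suc m) = Product.product (powers D A m) D A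

replication-powers : ∀ {k} (D : Design k) A m → m ≤ Design.replication (powers D A m)
replication-powers D A zero    = z≤n
replication-powers D A (suc m) =
  +-mono-≤ (Design.replication>0 D) (≤-trans (replication-powers D A m) (m≤n*m _ (Design.points D)))
  where instance _ = >-nonZero (Design.points>0 D)

extremal-graphs : ∀ {k} → 2 ≤ k → (D : Design k) → LabelledOA k (Design.points D) →
                  ∀ N → ∃ λ Δ → N ≤ Δ × k + 2 ≤ Δ ×
                  Σ Graph (λ G → HasMaxDegree G Δ × ChiR≡ G k ((k ∸ 1) * Δ + 1))
extremal-graphs {k} 2≤k D A N =
  replication , ≤-trans (m≤m+n N (k + 2)) m≤Δ , ≤-trans (m≤n+m (k + 2) N) m≤Δ ,
  graph , proj₁ extremal , subst (ChiR≡ graph k) points≡ (proj₂ extremal)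
  where
  m : ℕ
  m = N + (k + 2)

  S : Design k
  S = powers D A (suc m)

  open Design S
  open IncidenceGraph S using (graph; incidenceGraph-extremal)

  m≤Δ : m ≤ replication
  m≤Δ = ≤-trans (n≤1+n m) (replication-powers D A (suc m))

  extremal : HasMaxDegree graph replication × ChiR≡ graph k points
  extremal = incidenceGraph-extremal (Product.productColouring (powers D A m) D A 2≤k)
                                     (≤-trans (≤-trans (m≤m+n k 2) (m≤n+m (k + 2) N)) m≤Δ)

-- Orthogonal arrays from finite fields

-- The lines α + β·embed j form a labelled OA(k, w) as soon as the operations
-- satisfy Laws; for a concrete field, `checkLaws` decides them by evaluation.
module AffineLines {k w : ℕ} .{{_ : NonZero k}} .{{_ : NonZero w}}
                   (_⊕_ _⊖_ _⊛_ : Fin w → Fin w → Fin w) (_⁻¹ : Fin w → Fin w) where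

  embed : Fin k → Fin w
  embed j = toℕ j mod w

  slopeLabel : Fin w → Fin k
  slopeLabel β = toℕ β mod k

  line : Fin w → Fin w → Fin k → Fin w
  line β α j = α ⊕ (β ⊛ embed j)

  Through : Fin k → Fin k → Fin w → Set
  Through j j′ s = ∀ a a′ → let β = (a ⊖ a′) ⊛ s in line β (a ⊖ (β ⊛ embed j)) j′ ≡ a′

  Laws : Set
  Laws = (∀ a c → (a ⊖ c) ⊕ c ≡ a) × (∀ x c → (x ⊕ c) ⊖ c ≡ x) × (∀ i → slopeLabel (embed i) ≡ i) ×
         (∀ j j′ → j ≢ j′ → Through j j′ ((embed j ⊖ embed j′) ⁻¹))

  joins : Fin k → Fin k → Fin w → Fin w → Fin w → Bool
  joins j j′ a a′ β = line β (a ⊖ (β ⊛ embed j)) j′ == a′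

  -- The inverse is an argument of `through`, so it is computed once per pair of columns.
  through : Fin k → Fin k → Fin w → Bool
  through j j′ s = all λ a → all λ a′ → joins j j′ a a′ ((a ⊖ a′) ⊛ s)

  checkLaws : Bool
  checkLaws = all (λ a → all λ c → (a ⊖ c) ⊕ c == a) ∧ all (λ x → all λ c → (x ⊕ c) ⊖ c == x) ∧
         all (λ i → slopeLabel (embed i) == i) ∧ all (λ j → all (throughAll j))
    where
    throughAll : Fin k → Fin k → Bool
    throughAll j j′ = (j == j′) ∨ through j j′ ((embed j ⊖ embed j′) ⁻¹)

  checkLaws-sound : checkLaws ≡ true → Laws
  checkLaws-sound ok with ⊖⊕ , ok₁ ← ∧≡true ok
                     with ⊕⊖ , ok₂ ← ∧≡true ok₁
                     with labels , lines ← ∧≡true ok₂ =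
    (λ a c → ==⇒≡ (all₂-sound _ ⊖⊕ a c)) ,
    (λ x c → ==⇒≡ (all₂-sound _ ⊕⊖ x c)) ,
    (λ i → ==⇒≡ (all-sound _ labels i)) ,
    λ j j′ j≢j′ a a′ → ==⇒≡ (all₂-sound (λ a a′ → joins j j′ a a′ ((a ⊖ a′) ⊛ _))
                               (∨-resolveˡ (all₂-sound _ lines j j′) (≢⇒==-false j≢j′)) a a′)

  module _ (laws : Laws) where
    ⊖-⊕ : ∀ a c → (a ⊖ c) ⊕ c ≡ a
    ⊖-⊕ = proj₁ laws

    ⊕-⊖ : ∀ x c → (x ⊕ c) ⊖ c ≡ x
    ⊕-⊖ = proj₁ (proj₂ laws)

    label-embed : ∀ i → slopeLabel (embed i) ≡ i
    label-embed = proj₁ (proj₂ (proj₂ laws))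

    two-point-lines : ∀ j j′ → j ≢ j′ → Through j j′ ((embed j ⊖ embed j′) ⁻¹)
    two-point-lines = proj₂ (proj₂ (proj₂ laws))

    entry : Fin (w * w) → Fin k → Fin w
    entry g = uncurry line (remQuot w g)

    entry-combine : ∀ β α → entry (combine β α) ≡ line β α
    entry-combine β α = cong (uncurry line) (Finₚ.remQuot-combine β α)

    line-through : ∀ β a j → line β (a ⊖ (β ⊛ embed j)) j ≡ a
    line-through β a j = ⊖-⊕ a (β ⊛ embed j)

    entry-count : ∀ j a → count (λ g → entry g j == a) ≡ w
    entry-count j a = begin
      count (λ g → entry g j == a)                               ≡⟨ sum-combine w _ ⟩
      sum {w} (λ β → count (λ α → entry (combine β α) j == a))   ≡⟨ sum-cong-≗ unique-intercept ⟩
      count {w} (λ _ → true)                                     ≡⟨ count-all w ⟩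
      w                                                          ∎
      where
      open ≡-Reasoning
      unique-intercept : ∀ β → count (λ α → entry (combine β α) j == a) ≡ 1
      unique-intercept β = begin
        count (λ α → entry (combine β α) j == a) ≡⟨ count-cong (λ α → cong (λ f → f j == a) (entry-combine β α)) ⟩
        count (λ α → α ⊕ c == a)                 ≡⟨ count-cong solves ⟩
        count (a ⊖ c ==_)                        ≡⟨ count-==ˡ (a ⊖ c) ⟩
        1                                        ∎
        where
        c : Fin w
        c = β ⊛ embed j
        solves : ∀ α → (α ⊕ c == a) ≡ (a ⊖ c == α)
        solves α = ==-≡ (λ eq → trans (cong (_⊖ c) (sym eq)) (⊕-⊖ α c)) (λ eq → trans (cong (_⊕ c) (sym eq)) (⊖-⊕ a c))

    linesOA : LabelledOA k w
    linesOA = record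
      { rows = w * w
      ; entry = entry
      ; entry-count = entry-count
      ; pair-covered = covered
      ; label = slopeLabel ∘ proj₁ ∘ remQuot w
      ; labels-through = λ j a i → combine (embed i) (a ⊖ (embed i ⊛ embed j)) ,
          trans (cong (λ f → f j) (entry-combine _ _)) (line-through (embed i) a j) ,
          trans (cong (slopeLabel ∘ proj₁) (Finₚ.remQuot-combine (embed i) _)) (label-embed i)
      }
      where
      covered : ∀ {j j′} a a′ → j ≢ j′ → ∃ λ g → entry g j ≡ a × entry g j′ ≡ a′
      covered {j} {j′} a a′ j≢j′ = combine β (a ⊖ (β ⊛ embed j)) ,
        trans (cong (λ f → f j) (entry-combine _ _)) (line-through β a j) ,
        trans (cong (λ f → f j′) (entry-combine _ _)) (two-point-lines j j′ j≢j′ a a′)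
        where
        β : Fin w
        β = (a ⊖ a′) ⊛ ((embed j ⊖ embed j′) ⁻¹)

-- An element of GF(pⁿ) = 𝔽ₚ[X]/(Xⁿ − r) is encoded by its base-p digits, digit i
-- being the coefficient of Xⁱ; `reduction` encodes r.
module GaloisField (p n : ℕ) .{{_ : NonZero p}} (reduction : ℕ) where
  q : ℕ
  q = p ^ n

  instance
    q≢0 : NonZero q
    q≢0 = m^n≢0 p n
    pⁿ⁻¹≢0 : NonZero (p ^ (n ∸ 1))
    pⁿ⁻¹≢0 = m^n≢0 p (n ∸ 1)

  digitwise : (ℕ → ℕ → ℕ) → ℕ → ℕ → ℕ → ℕ
  digitwise f zero    x y = 0
  digitwise f (suc m) x y = f (x % p) (y % p) % p + p * digitwise f m (x / p) (y / p)

  add sub : ℕ → ℕ → ℕ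
  add = digitwise _+_ n
  sub = digitwise (λ a b → a + (p ∸ 1) * b) n

  scale : ℕ → ℕ → ℕ
  scale c y = digitwise (λ a _ → c * a) n y 0

  timesX : ℕ → ℕ
  timesX y = add (p * (y % p ^ (n ∸ 1))) (scale (y / p ^ (n ∸ 1)) reduction)

  times : ℕ → ℕ → ℕ → ℕ
  times zero    x y = 0
  times (suc m) x y = add (scale (x % p) y) (timesX (times m (x / p) y))

  _⊕_ _⊖_ _⊛_ : Fin q → Fin q → Fin q
  x ⊕ y = add (toℕ x) (toℕ y) mod q
  x ⊖ y = sub (toℕ x) (toℕ y) mod q
  x ⊛ y = times n (toℕ x) (toℕ y) mod q

  _⁻¹ : Fin q → Fin q
  x ⁻¹ = power (q ∸ 2)
    where
    power : ℕ → Fin q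
    power zero    = 1 mod q
    power (suc m) = x ⊛ power m

  linearOA : ∀ k .{{_ : NonZero k}} → AffineLines.checkLaws {k} _⊕_ _⊖_ _⊛_ _⁻¹ ≡ true → LabelledOA k q
  linearOA k ok = AffineLines.linesOA _⊕_ _⊖_ _⊛_ _⁻¹ (AffineLines.checkLaws-sound _⊕_ _⊖_ _⊛_ _⁻¹ ok)

-- Base designs

singleBlock : ∀ k → Design (suc k)
singleBlock k = record
  { points            = suc k
  ; blocks            = 1
  ; replication       = 1
  ; point             = λ _ i → i
  ; point-injective   = λ _ eq → eq
  ; replication-count = λ x → cong (λ b → indicator b + 0) (any-intro {f = _== x} x (==-refl x))
  ; pair-covered      = λ {x} {y} _ → zero , (x , refl) , (y , refl)
  ; points≡           = trans (+-comm 1 k) (cong (_+ 1) (sym (*-identityʳ k)))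
  ; replication>0     = s≤s z≤n
  }

-- PG(2, 5): the translates of the perfect difference set {0, 1, 3, 8, 12, 18} mod 31.
module SingerPlane where

  base : Fin 6 → ℕ
  base = lookup (0 ∷ 1 ∷ 3 ∷ 8 ∷ 12 ∷ 18 ∷ [])

  difference : ℕ → ℕ → ℕ
  difference a b = (a + (31 ∸ b)) % 31

  point : Fin 31 → Fin 6 → Fin 31
  point ℓ i = (toℕ ℓ + base i) mod 31

  shift : Fin 31 → Fin 6 → Fin 31
  shift x i = difference (toℕ x) (base i) mod 31

  injectiveAt : Fin 31 → Fin 6 → Fin 6 → Bool
  injectiveAt ℓ i j = not (point ℓ i == point ℓ j) ∨ (i == j)

  point-injective : ∀ ℓ → Injective _≡_ _≡_ (point ℓ)
  point-injective ℓ {i} {j} eq =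
    ==⇒≡ (∨-resolveˡ (all-sound (injectiveAt ℓ i) (all₂-sound (λ ℓ i → all (injectiveAt ℓ i)) refl ℓ i) j)
                     (cong not (trans (cong (_== point ℓ j) eq) (==-refl (point ℓ j)))))

  replication-count : ∀ x → count (λ ℓ → incident point x ℓ) ≡ 6
  replication-count x = ≡ᵇ⇒≡ _ 6 (subst T (sym (all-sound (λ x → count (incident point x) ≡ᵇ 6) refl x)) _)

  shift-point : ∀ x i → point (shift x i) i ≡ x
  shift-point x i = ==⇒≡ (all₂-sound (λ x i → point (shift x i) i == x) refl x i)

  -- The block shift x i contains y iff base j − base i ≡ y − x for some j;
  -- testing that difference first keeps the search cheap.
  joinedVia : Fin 31 → Fin 31 → Fin 6 → Fin 6 → Bool
  joinedVia x y i j = (difference (base j) (base i) ≡ᵇ difference (toℕ y) (toℕ x)) ∧ (point (shift x i) j == y)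

  joinedAt : Fin 31 → Fin 31 → Bool
  joinedAt x y = (x == y) ∨ any λ i → any (joinedVia x y i)

  joined : ∀ {x y} → x ≢ y → ∃ λ i → ∃ λ j → point (shift x i) j ≡ y
  joined {x} {y} x≢y
    with i , found ← any-elim (λ i → any (joinedVia x y i))
                               (∨-resolveˡ (all₂-sound joinedAt refl x y) (≢⇒==-false x≢y))
    with j , found′ ← any-elim (joinedVia x y i) found = i , j , ==⇒≡ (proj₂ (∧≡true found′))

  plane : Design 6
  plane = record
    { points            = 31
    ; blocks            = 31
    ; replication       = 6
    ; point             = point
    ; point-injective   = point-injective
    ; replication-count = replication-count
    ; pair-covered      = covered
    ; points≡           = refl
    ; replication>0     = s≤s z≤n
    }
    where
    -- A `with` on `joined x≢y` would make Agda evaluate the underlying check again.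
    covered : ∀ {x y} → x ≢ y → ∃ λ ℓ → OnBlock point x ℓ × OnBlock point y ℓ
    covered {x} x≢y = let i , j , y∈ℓ = joined x≢y in shift x i , (i , shift-point x i) , (j , y∈ℓ)

ingredients : ∀ r → 2 ≤ r → r ≤ 9 → Σ (Design r) λ D → LabelledOA r (Design.points D)
ingredients 0 () _
ingredients 1 (s≤s ()) _
ingredients 2 _ _ = singleBlock 1 , GaloisField.linearOA 2 1 0 2 refl
ingredients 3 _ _ = singleBlock 2 , GaloisField.linearOA 3 1 0 3 refl
ingredients 4 _ _ = singleBlock 3 , GaloisField.linearOA 2 2 3 4 refl
ingredients 5 _ _ = singleBlock 4 , GaloisField.linearOA 5 1 0 5 refl
ingredients 6 _ _ = SingerPlane.plane , GaloisField.linearOA 31 1 0 6 refl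
ingredients 7 _ _ = singleBlock 6 , GaloisField.linearOA 7 1 0 7 refl
ingredients 8 _ _ = singleBlock 7 , GaloisField.linearOA 2 3 3 8 refl
ingredients 9 _ _ = singleBlock 8 , GaloisField.linearOA 3 2 2 9 refl
ingredients (suc (suc (suc (suc (suc (suc (suc (suc (suc (suc _)))))))))) _
            (s≤s (s≤s (s≤s (s≤s (s≤s (s≤s (s≤s (s≤s (s≤s ())))))))))

theorem6 : (r : ℕ) → 2 ≤ r → r ≤ 9 →
    ∀ (N : ℕ) → ∃ λ (Δ : ℕ) → N ≤ Δ × r + 2 ≤ Δ ×
      Σ Graph (λ G → HasMaxDegree G Δ × ChiR≡ G r ((r ∸ 1) * Δ + 1))
theorem6 r 2≤r r≤9 = uncurry (extremal-graphs 2≤r) (ingredients r 2≤r r≤9)
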